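{- Let $M$ be a regular matroid on $E$ with a triangulating circuit-cocircuit signature $(\sigma,\sigma^*)$, let $\vec f$ be an arc and $B_1,B_2\in\mathbf B(M)$ with $[\vec f]\cdot\beta_{(M,\sigma,\sigma^*)}(B_1)=\beta_{(M,\sigma,\sigma^*)}(B_2)$. Write $\vec O_i=\beta_{(M,\sigma,\sigma^*)}(B_i)$, $\vec F=\vec F(B_1,\sigma)\cap-\vec F(B_2,\sigma)$ and $\vec F^*=(\vec F(B_1,\sigma^*)\cap-\vec F(B_2,\sigma^*))^c$. Then for $x\in E$ (regarding $\vec O_i(x)$ as the one-element subset of $\{+,-\}$): (1) if $\vec O_1(x)=\vec O_2(x)$ then $\vec F(x)=\vec F^*(x)$; (2) if $\vec O_1(x)=\vec O_2(x)$ and $x\notin B_1\cup B_2$ then $\vec F(x)=\vec F^*(x)=\emptyset$; (3) if $\vec O_1(x)\ne\vec O_2(x)$ then $\vec O_1(x)\subseteq\vec F(x)$ and $\vec F^*(x)\subseteq\vec O_2(x)$; (4) if $\vec O_1(x)\ne\vec O_2(x)$ and $x\notin B_1\cup B_2$ then $\vec F(x)=\vec O_1(x)$ and $\vec F^*(x)=\emptyset$.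
   Context: $M=M(A)$ is the regular matroid on finite $E$ represented by a real totally unimodular matrix $A$ of full row rank (bases: index sets of nonsingular maximal square submatrices; circuits: minimal sets in no basis; cocircuits: minimal sets meeting every basis). An arc is a 1-chain in $\mathbb Z^E$ with coefficients in $\{ -1,0,1\}$ and one-element support. A signed circuit (cocircuit) is an element of $\ker A$ (row space of $A$) with coefficients in $\{ -1,0,1\}$ whose support is a circuit (cocircuit). An orientation is a map $E\to\{+,-\}$; $\vec P\sim\vec O$ means the sign of $\vec P(x)$ equals $\vec O(x)$ for all $x$ in the support; $\mathrm{rev}_P(\vec O)$ flips $\vec O$ on $P$. Circuit-cocircuit equivalence is generated by $\vec O\mapsto\mathrm{rev}_C(\vec O)$ for signed circuits/cocircuits $\vec C\sim\vec O$. $S(M)=\mathbb Z^E/(\Lambda+\Lambda^*)$ ($\Lambda,\Lambda^*$ generated by signed circuits, signed cocircuits) acts canonically on classes: for an arc $\vec f$ and class $G$, pick $\vec O\in G$ with $-\vec f\sim\vec O$ and set $[\vec f]\cdot G=[\mathrm{rev}_{\{f\}}(\vec O)]$. A circuit signature $\sigma$ picks one signed circuit $\sigma(C)$ per circuit; cocircuit signatures likewise. Fourientations are maps $E\to$ subsets of $\{+,-\}$ (written $\emptyset,+,-,\pm$); $-\vec F$ swaps $+,-$; $\vec F^c(x)=\{+,-\}\setminus\vec F(x)$; $\cap$ pointwise; a 1-chain is compatible with $\vec F$ if the sign of each nonzero coefficient at $x$ lies in $\vec F(x)$. $\vec F(B,\sigma)$ is $\pm$ on $B$ and at $x\notin B$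 the sign of $\sigma(C_x)(x)$ ($C_x$ the fundamental circuit in $B\cup\{x\}$); $\vec F(B,\sigma^*)$ is $\pm$ off $B$ and at $x\in B$ the sign of $\sigma^*(C^*_x)(x)$ ($C^*_x$ the fundamental cocircuit in $(E\setminus B)\cup\{x\}$). $(\sigma,\sigma^*)$ is triangulating if for distinct bases $B_1,B_2$ no signed circuit is compatible with $\vec F(B_1,\sigma)\cap-\vec F(B_2,\sigma)$ and no signed cocircuit with $\vec F(B_1,\sigma^*)\cap-\vec F(B_2,\sigma^*)$. An orientation is $(\sigma,\sigma^*)$-compatible if all compatible signed circuits lie in $\sigma$ and all compatible signed cocircuits in $\sigma^*$; each class has exactly one, $[\vec O]^\circ$, and $s\cdot\vec O:=(s\cdot[\vec O])^\circ$. $\beta_{(M,\sigma,\sigma^*)}(B)=\vec F(B,\sigma)\cap\vec F(B,\sigma^*)$ is a bijection from bases onto $(\sigma,\sigma^*)$-compatible orientations. -}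

module Defs where

open import Data.Nat as ℕ using (ℕ; zero; suc)
open import Data.Integer as ℤ using (ℤ; +_; -_; sign)
open import Data.Rational as ℚ using (ℚ; 0ℚ)
open import Data.Fin using (Fin; zero; suc; punchIn; toℕ)
open import Data.Fin.Subset using (Subset; _∈_; _∉_; _⊆_; _⊂_; _∪_; ∁; ⁅_⁆)
open import Data.Vec using (tabulate)
open import Data.Sign using (Sign; opposite)
open import Data.Bool using (Bool; true; false; if_then_else_; not)
open import Data.Product using (Σ; ∃; ∃-syntax; _×_; _,_)
open import Data.Sum using (_⊎_)
open import Data.Empty using (⊥)
open import Relation.Nullary using (¬_; does)
open import Relation.Binary.PropositionalEquality using (_≡_; _≢_)
open import Relation.Binary.Construct.Closure.Equivalence using (EqClosure)
open import Function.Definitions using (Injective)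
open import Function.Bundles using (_⇔_)

∑ℤ : ∀ {k} → (Fin k → ℤ) → ℤ
∑ℤ {zero}  f = + 0
∑ℤ {suc k} f = f zero ℤ.+ ∑ℤ (λ i → f (suc i))

∑ℚ : ∀ {k} → (Fin k → ℚ) → ℚ
∑ℚ {zero}  f = 0ℚ
∑ℚ {suc k} f = f zero ℚ.+ ∑ℚ (λ i → f (suc i))

toℚ : ℤ → ℚ
toℚ z = z ℚ./ 1

Matrix : ℕ → ℕ → Set
Matrix r n = Fin r → Fin n → ℤ

altSign : ℕ → ℤ
altSign zero          = + 1
altSign (suc zero)    = - (+ 1)
altSign (suc (suc k)) = altSign k

det : ∀ k → (Fin k → Fin k → ℤ) → ℤ
det zero    M = + 1
det (suc k) M =
  ∑ℤ (λ j → altSign (toℕ j) ℤ.* (M zero j ℤ.* det k (λ i j′ → M (suc i) (punchIn j j′))))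

TU : ∀ {r n} → Matrix r n → Set
TU {r} {n} A = ∀ k (rs : Fin k → Fin r) (cs : Fin k → Fin n) →
  Injective _≡_ _≡_ rs → Injective _≡_ _≡_ cs →
  let d = det k (λ i j → A (rs i) (cs j)) in
  (d ≡ - (+ 1)) ⊎ (d ≡ + 0) ⊎ (d ≡ + 1)

FullRowRank : ∀ {r n} → Matrix r n → Set
FullRowRank {r} {n} A = ∃ λ (cs : Fin r → Fin n) → det r (λ i j → A i (cs j)) ≢ + 0

IsBasis : ∀ {r n} → Matrix r n → Subset n → Set
IsBasis {r} {n} A B = Σ (Fin r → Fin n) λ cs →
  Injective _≡_ _≡_ cs × (∀ x → (x ∈ B) ⇔ (∃[ j ] cs j ≡ x)) ×
  det r (λ i j → A i (cs j)) ≢ + 0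

InSomeBasis : ∀ {r n} → Matrix r n → Subset n → Set
InSomeBasis A X = ∃[ B ] IsBasis A B × X ⊆ B

IsCircuit : ∀ {r n} → Matrix r n → Subset n → Set
IsCircuit A C = ¬ InSomeBasis A C × (∀ D → D ⊂ C → InSomeBasis A D)

MeetsEveryBasis : ∀ {r n} → Matrix r n → Subset n → Set
MeetsEveryBasis A X = ∀ B → IsBasis A B → ∃[ x ] x ∈ X × x ∈ B

IsCocircuit : ∀ {r n} → Matrix r n → Subset n → Set
IsCocircuit A C = MeetsEveryBasis A C × (∀ D → D ⊂ C → ¬ MeetsEveryBasis A D)

Chain : ℕ → Set
Chain n = Fin n → ℤ

isNonZero : ℤ → Bool
isNonZero z = not (does (z ℤ.≟ + 0))

supp : ∀ {n} → Chain n → Subset n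
supp v = tabulate (λ x → isNonZero (v x))

Ternary : ∀ {n} → Chain n → Set
Ternary v = ∀ x → (v x ≡ - (+ 1)) ⊎ (v x ≡ + 0) ⊎ (v x ≡ + 1)

SuppIs : ∀ {n} → Chain n → Subset n → Set
SuppIs v C = ∀ x → (x ∈ C) ⇔ (v x ≢ + 0)

InKernel : ∀ {r n} → Matrix r n → Chain n → Set
InKernel A v = ∀ i → ∑ℤ (λ x → A i x ℤ.* v x) ≡ + 0

-- row space of A (over ℚ, which for the rational matrix A and integral v
-- is the same as over ℝ)
InRowSpace : ∀ {r n} → Matrix r n → Chain n → Set
InRowSpace {r} {n} A v = ∃ λ (y : Fin r → ℚ) → ∀ x → ∑ℚ (λ i → y i ℚ.* toℚ (A i x)) ≡ toℚ (v x)

SignedCircuit : ∀ {r n} → Matrix r n → Chain n → Set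
SignedCircuit A v = InKernel A v × Ternary v × IsCircuit A (supp v)

SignedCocircuit : ∀ {r n} → Matrix r n → Chain n → Set
SignedCocircuit A v = InRowSpace A v × Ternary v × IsCocircuit A (supp v)

Orientation : ℕ → Set
Orientation n = Fin n → Sign

_∼_ : ∀ {n} → Chain n → Orientation n → Set
P ∼ O = ∀ x → P x ≢ + 0 → sign (P x) ≡ O x

rev : ∀ {n} → Chain n → Orientation n → Orientation n
rev P O x = if isNonZero (P x) then opposite (O x) else O x

_≗_ : ∀ {n} → Orientation n → Orientation n → Set
O ≗ O′ = ∀ x → O x ≡ O′ x

CCStep : ∀ {r n} → Matrix r n → Orientation n → Orientation n → Set
CCStep A O O′ = ∃[ v ] (SignedCircuit A v ⊎ SignedCocircuit A v) × v ∼ O × O′ ≗ rev v O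

CCEquiv : ∀ {r n} → Matrix r n → Orientation n → Orientation n → Set
CCEquiv A = EqClosure (CCStep A)

flipAt : ∀ {n} → Fin n → Orientation n → Orientation n
flipAt e O x = if does (x Data.Fin.≟ e) then opposite (O x) else O x

-- σ(C) for each circuit C (values on non-circuits irrelevant)
CircuitSignature : ∀ {r n} → Matrix r n → (Subset n → Chain n) → Set
CircuitSignature A σ = ∀ C → IsCircuit A C → SignedCircuit A (σ C) × SuppIs (σ C) C

CocircuitSignature : ∀ {r n} → Matrix r n → (Subset n → Chain n) → Set
CocircuitSignature A σ = ∀ C → IsCocircuit A C → SignedCocircuit A (σ C) × SuppIs (σ C) C

InSig : ∀ {n} → (Subset n → Chain n) → Chain n → Set
InSig σ v = ∀ x → v x ≡ σ (supp v) x

CompatibleOrientation : ∀ {r n} → Matrix r n → (σ σ* : Subset n → Chain n) →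
  Orientation n → Set
CompatibleOrientation A σ σ* O =
  (∀ v → SignedCircuit A v → v ∼ O → InSig σ v) ×
  (∀ v → SignedCocircuit A v → v ∼ O → InSig σ* v)

-- Fourientations, represented as F x s  ⇔  s ∈ F(x)

Fourientation : ℕ → Set₁
Fourientation n = Fin n → Sign → Set

_∩F_ : ∀ {n} → Fourientation n → Fourientation n → Fourientation n
(F ∩F G) x s = F x s × G x s

−F_ : ∀ {n} → Fourientation n → Fourientation n
(−F F) x s = F x (opposite s)

_ᶜ : ∀ {n} → Fourientation n → Fourientation n
(F ᶜ) x s = ¬ F x s

single : ∀ {n} → Orientation n → Fourientation n
single O x s = O x ≡ s

CompatibleChain : ∀ {n} → Chain n → Fourientation n → Set
CompatibleChain v F = ∀ x → v x ≢ + 0 → F x (sign (v x))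

-- F(B,σ): ± on B; off B the sign of σ(C_x)(x), C_x the fundamental circuit
-- (the unique circuit contained in B ∪ {x})
Fσ : ∀ {r n} → Matrix r n → (Subset n → Chain n) → Subset n → Fourientation n
Fσ A σ B x s = (x ∈ B) ⊎
  (x ∉ B × ∃[ C ] IsCircuit A C × C ⊆ (B ∪ ⁅ x ⁆) × x ∈ C × sign (σ C x) ≡ s)

-- F(B,σ*): ± off B; on B the sign of σ*(C*_x)(x), C*_x the fundamental
-- cocircuit (the unique cocircuit contained in (E∖B) ∪ {x})
Fσ* : ∀ {r n} → Matrix r n → (Subset n → Chain n) → Subset n → Fourientation n
Fσ* A σ* B x s = (x ∉ B) ⊎
  (x ∈ B × ∃[ D ] IsCocircuit A D × D ⊆ (∁ B ∪ ⁅ x ⁆) × x ∈ D × sign (σ* D x) ≡ s)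

Triangulating : ∀ {r n} → Matrix r n → (σ σ* : Subset n → Chain n) → Set
Triangulating A σ σ* = ∀ B₁ B₂ → IsBasis A B₁ → IsBasis A B₂ → B₁ ≢ B₂ →
  (∀ v → SignedCircuit A v → ¬ CompatibleChain v (Fσ A σ B₁ ∩F (−F Fσ A σ B₂))) ×
  (∀ v → SignedCocircuit A v → ¬ CompatibleChain v (Fσ* A σ* B₁ ∩F (−F Fσ* A σ* B₂)))

IsBeta : ∀ {r n} → Matrix r n → (σ σ* : Subset n → Chain n) → Subset n →
  Orientation n → Set
IsBeta A σ σ* B O = ∀ x s → single O x s ⇔ (Fσ A σ B x s × Fσ* A σ* B x s)

-- [f] · O = O′ for the arc f = s·e, i.e. O′ = ([f]·[O])°: O′ is the
-- (σ,σ*)-compatible orientation in the class [rev_{e}(O₀)] where O₀ ∈ [O]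
-- with -f ∼ O₀, i.e. O₀(e) = -s.
ActsTo : ∀ {r n} → Matrix r n → (σ σ* : Subset n → Chain n) →
  Fin n → Sign → Orientation n → Orientation n → Set
ActsTo A σ σ* e s O O′ =
  (∃[ O₀ ] CCEquiv A O O₀ × O₀ e ≡ opposite s × CCEquiv A (flipAt e O₀) O′) ×
  CompatibleOrientation A σ σ* O′

SameAt : ∀ {n} → Fourientation n → Fourientation n → Fin n → Set
SameAt F G x = ∀ s → F x s ⇔ G x s

SubAt : ∀ {n} → Fourientation n → Fourientation n → Fin n → Set
SubAt F G x = ∀ s → F x s → G x s

EmptyAt : ∀ {n} → Fourientation n → Fin n → Set
EmptyAt F x = ∀ s → ¬ F x s

module Submission where

open import Defs
open import Data.Fin using (Fin)
open import Data.Fin.Subset using (Subset; _∉_; _∪_)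
open import Data.Fin.Subset.Properties using (_∈?_; p⊆p∪q; q⊆p∪q)
open import Data.Sign using (Sign; opposite) renaming (+ to ⊕; - to ⊖)
open import Data.Sign.Properties using (s≢opposite[s]; opposite-involutive)
  renaming (_≟_ to _≟ˢ_)
open import Data.Product using (_×_; _,_; proj₁)
open import Data.Sum using (inj₁)
open import Data.Empty using (⊥-elim)
open import Relation.Nullary using (yes; no)
open import Relation.Nullary.Decidable using (decidable-stable)
open import Function using (_∘_)
open import Function.Bundles using (mk⇔; Equivalence)
open import Relation.Binary.PropositionalEquality using (_≡_; _≢_; refl; sym; trans)

open Equivalence

-- Every claim is a pointwise consequence of β(B) = F(B,σ) ∩ F(B,σ*): at x one
-- of the two factors is ± (F(B,σ) if x ∈ B, F(B,σ*) if x ∉ B) and the other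
-- is {β(B)(x)}.

≢⇒≡opposite : ∀ {o s} → o ≢ s → o ≡ opposite s
≢⇒≡opposite {⊕} {⊕} o≢s = ⊥-elim (o≢s refl)
≢⇒≡opposite {⊕} {⊖} _   = refl
≢⇒≡opposite {⊖} {⊕} _   = refl
≢⇒≡opposite {⊖} {⊖} o≢s = ⊥-elim (o≢s refl)

≢opposite⇒≡ : ∀ {o s} → o ≢ opposite s → o ≡ s
≢opposite⇒≡ {s = s} o≢-s = trans (≢⇒≡opposite o≢-s) (opposite-involutive s)

≢∧≡⇒≡opposite : ∀ {o₁ o₂ s} → o₁ ≢ o₂ → o₁ ≡ s → o₂ ≡ opposite s
≢∧≡⇒≡opposite o₁≢o₂ refl = ≢⇒≡opposite (λ o₂≡o₁ → o₁≢o₂ (sym o₂≡o₁))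

≡∧≡opposite⇒≢ : ∀ {o₁ o₂ s} → o₁ ≡ s → o₂ ≡ opposite s → o₁ ≢ o₂
≡∧≡opposite⇒≢ {s = s} refl refl = s≢opposite[s] s

module IsBetaProperties {r n} (A : Matrix r n) (σ σ* : Subset n → Chain n)
                        {B : Subset n} {O : Orientation n} (β : IsBeta A σ σ* B O)
                        {x : Fin n} {s : Sign} where

  β⇒Fσ : O x ≡ s → Fσ A σ B x s
  β⇒Fσ Ox≡s = let (f , _) = to (β x s) Ox≡s in f

  β⇒Fσ* : O x ≡ s → Fσ* A σ* B x s
  β⇒Fσ* Ox≡s = let (_ , f*) = to (β x s) Ox≡s in f*

  Fσ∧Fσ*⇒β : Fσ A σ B x s → Fσ* A σ* B x s → O x ≡ s
  Fσ∧Fσ*⇒β f f* = from (β x s) (f , f*)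

  Fσ-∉⇒β : x ∉ B → Fσ A σ B x s → O x ≡ s
  Fσ-∉⇒β x∉B f = Fσ∧Fσ*⇒β f (inj₁ x∉B)

  Fσ-intro : (x ∉ B → O x ≡ s) → Fσ A σ B x s
  Fσ-intro h with x ∈? B
  ... | yes x∈B = inj₁ x∈B
  ... | no  x∉B = β⇒Fσ (h x∉B)

module PointwiseAt {r n} (A : Matrix r n) (σ σ* : Subset n → Chain n)
                   {B₁ B₂ : Subset n} {O₁ O₂ : Orientation n}
                   (β₁ : IsBeta A σ σ* B₁ O₁) (β₂ : IsBeta A σ σ* B₂ O₂) (x : Fin n) where

  module β₁ = IsBetaProperties A σ σ* β₁
  module β₂ = IsBetaProperties A σ σ* β₂

  F F* : Fourientation n
  F  = Fσ A σ B₁ ∩F (−F Fσ A σ B₂)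
  F* = (Fσ* A σ* B₁ ∩F (−F Fσ* A σ* B₂)) ᶜ

  F*-empty-∉∪ : x ∉ B₁ ∪ B₂ → EmptyAt F* x
  F*-empty-∉∪ x∉B₁∪B₂ s ¬F* =
    ¬F* (inj₁ (x∉B₁∪B₂ ∘ p⊆p∪q B₂) ,
         inj₁ (x∉B₁∪B₂ ∘ q⊆p∪q B₁ B₂))

  F-∉∪⇒β : x ∉ B₁ ∪ B₂ → ∀ {s} → F x s → O₁ x ≡ s × O₂ x ≡ opposite s
  F-∉∪⇒β x∉B₁∪B₂ (f₁ , f₂) =
    β₁.Fσ-∉⇒β (x∉B₁∪B₂ ∘ p⊆p∪q B₂) f₁ ,
    β₂.Fσ-∉⇒β (x∉B₁∪B₂ ∘ q⊆p∪q B₁ B₂) f₂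

  agree⇒F≈F* : O₁ x ≡ O₂ x → SameAt F F* x
  agree⇒F≈F* O₁x≡O₂x s = mk⇔ F⇒F* F*⇒F
    where
    F⇒F* : F x s → F* x s
    F⇒F* (f₁ , f₂) (f₁* , f₂*) =
      ≡∧≡opposite⇒≢ (β₁.Fσ∧Fσ*⇒β f₁ f₁*) (β₂.Fσ∧Fσ*⇒β f₂ f₂*) O₁x≡O₂x

    F*⇒F : F* x s → F x s
    F*⇒F ¬F* =
      β₁.Fσ-intro (λ x∉B₁ → decidable-stable (O₁ x ≟ˢ s) λ O₁x≢s →
        ¬F* (inj₁ x∉B₁ , β₂.β⇒Fσ* (trans (sym O₁x≡O₂x) (≢⇒≡opposite O₁x≢s)))) ,
      β₂.Fσ-intro (λ x∉B₂ → decidable-stable (O₂ x ≟ˢ opposite s) λ O₂x≢-s →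
        ¬F* (β₁.β⇒Fσ* (trans O₁x≡O₂x (≢opposite⇒≡ O₂x≢-s)) , inj₁ x∉B₂))

  agree⇒F-empty-∉∪ : O₁ x ≡ O₂ x → x ∉ B₁ ∪ B₂ → EmptyAt F x
  agree⇒F-empty-∉∪ O₁x≡O₂x x∉B₁∪B₂ s f =
    let (O₁x≡s , O₂x≡-s) = F-∉∪⇒β x∉B₁∪B₂ f in ≡∧≡opposite⇒≢ O₁x≡s O₂x≡-s O₁x≡O₂x

  differ⇒O₁⊆F : O₁ x ≢ O₂ x → SubAt (single O₁) F x
  differ⇒O₁⊆F O₁x≢O₂x s O₁x≡s = β₁.β⇒Fσ O₁x≡s , β₂.β⇒Fσ (≢∧≡⇒≡opposite O₁x≢O₂x O₁x≡s)

  differ⇒F*⊆O₂ : O₁ x ≢ O₂ x → SubAt F* (single O₂) x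
  differ⇒F*⊆O₂ O₁x≢O₂x s ¬F* = decidable-stable (O₂ x ≟ˢ s) λ O₂x≢s →
    let O₂x≡-s = ≢⇒≡opposite O₂x≢s
        O₁x≡s  = ≢opposite⇒≡ (λ O₁x≡-s → O₁x≢O₂x (trans O₁x≡-s (sym O₂x≡-s)))
    in ¬F* (β₁.β⇒Fσ* O₁x≡s , β₂.β⇒Fσ* O₂x≡-s)

  differ⇒F≈O₁-∉∪ : O₁ x ≢ O₂ x → x ∉ B₁ ∪ B₂ → SameAt F (single O₁) x
  differ⇒F≈O₁-∉∪ O₁x≢O₂x x∉B₁∪B₂ s =
    mk⇔ (λ f → proj₁ (F-∉∪⇒β x∉B₁∪B₂ f)) (differ⇒O₁⊆F O₁x≢O₂x s)

lemma4p10 : ∀ {r n} (A : Matrix r n) → TU A → FullRowRank A →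
    (σ σ* : Subset n → Chain n) →
    CircuitSignature A σ → CocircuitSignature A σ* → Triangulating A σ σ* →
    (e : Fin n) (s : Sign) (B₁ B₂ : Subset n) → IsBasis A B₁ → IsBasis A B₂ →
    (O₁ O₂ : Orientation n) → IsBeta A σ σ* B₁ O₁ → IsBeta A σ σ* B₂ O₂ →
    ActsTo A σ σ* e s O₁ O₂ →
    let F  = Fσ A σ B₁ ∩F (−F Fσ A σ B₂)
        F* = (Fσ* A σ* B₁ ∩F (−F Fσ* A σ* B₂)) ᶜ
    in ∀ x →
      (O₁ x ≡ O₂ x → SameAt F F* x) ×
      (O₁ x ≡ O₂ x → x ∉ (B₁ ∪ B₂) → EmptyAt F x × EmptyAt F* x) ×
      (O₁ x ≢ O₂ x → SubAt (single O₁) F x × SubAt F* (single O₂) x) ×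
      (O₁ x ≢ O₂ x → x ∉ (B₁ ∪ B₂) → SameAt F (single O₁) x × EmptyAt F* x)
lemma4p10 A _ _ σ σ* _ _ _ _ _ _ _ _ _ _ _ β₁ β₂ _ x =
  agree⇒F≈F* ,
  (λ agree x∉B₁∪B₂ → agree⇒F-empty-∉∪ agree x∉B₁∪B₂ , F*-empty-∉∪ x∉B₁∪B₂) ,
  (λ differ → differ⇒O₁⊆F differ , differ⇒F*⊆O₂ differ) ,
  (λ differ x∉B₁∪B₂ → differ⇒F≈O₁-∉∪ differ x∉B₁∪B₂ , F*-empty-∉∪ x∉B₁∪B₂)
  where open PointwiseAt A σ σ* β₁ β₂ x
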